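{- Let $T$ be a finite labelled rooted tree and let $G=(V,E)$ be the directed multigraph whose vertex set is $V=\{[u]_\sim : u\in T\}$ and in which, for $p,q\in V$, the pair $(p,q)$ appears in $E$ with multiplicity equal to the largest $k\geq 0$ such that there exist $u\in T$ and distinct $v_1,\dots,v_k\in\mathrm{children}(u)$ with $[u]_\sim=p$ and $[v_i]_\sim=q$ for all $i$. Let $S$ be the unique source of $G$. Let $U(G)$ be the unlabelled rooted tree whose nodes are the finite directed paths in $G$ starting at $S$ (including the empty path, which is the root), where parallel copies of an edge are regarded as distinct edges, and where the children of a path $\pi$ ending at a vertex $p$ are the paths obtained by appending to $\pi$ one edge leaving $p$. Then $U(G)$ is isomorphic to $T$ as an unlabelled rooted tree; that is, $G$ is a lossless compression of the topology of $T$ (the unlabelled isomorphism class of $T$ can be reconstructed from $G$).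
   Context: A labelled rooted tree $T$ is a finite rooted tree (edges directed from parent to child), each node $u$ carrying a label $\overline{u}$; $\mathrm{attr}(T)=\{\overline{u}:u\in T\}$; $\mathrm{children}(u)$ is the set of children of $u$ and $T(u)$ is the labelled subtree formed by $u$ and its descendants. A tree isomorphism $\phi:T_1\to T_2$ is a bijection on nodes such that $u$ is a child of $v$ iff $\phi(u)$ is a child of $\phi(v)$; it is a tree ciphering if there is a bijection $f_\phi:\mathrm{attr}(T_1)\to\mathrm{attr}(T_2)$ with $\overline{\phi(u)}=f_\phi(\overline{u})$ for all $u\in T_1$. $T_1\sim T_2$ means a tree ciphering exists (an equivalence relation); $[u]_\sim$ is the class of $T(u)$. $G$ is a directed acyclic multigraph with a unique source. -}

module Defs where

open import Data.Nat using (ℕ; _≤_)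
open import Data.Fin using (Fin)
open import Data.List using (List; length; lookup)
open import Data.Product using (Σ; ∃; _×_)
open import Relation.Binary.PropositionalEquality using (_≡_)
open import Relation.Nullary using (¬_)
open import Function.Bundles using (_↔_; _⇔_; Inverse)
open import Function.Definitions using (Injective)

-- Finite labelled rooted trees (the order of the child list carries no
-- meaning: all notions below are stated via node sets and bijections).

data Tree (A : Set) : Set where
  node : A → List (Tree A) → Tree A

data Pos {A : Set} : Tree A → Set where
  here  : ∀ {t} → Pos t
  there : ∀ {a ts} (i : Fin (length ts)) → Pos (lookup ts i) → Pos (node a ts)

data ChildPos {A : Set} : {t : Tree A} → Pos t → Pos t → Set where
  top  : ∀ {a ts} (i : Fin (length ts)) → ChildPos {t = node a ts} (there i here) here
  down : ∀ {a ts} (i : Fin (length ts)) {u v : Pos (lookup ts i)} →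
         ChildPos u v → ChildPos {t = node a ts} (there i u) (there i v)

label : {A : Set} (t : Tree A) → Pos t → A
label (node a ts) here        = a
label (node a ts) (there i p) = label (lookup ts i) p

sub : {A : Set} (t : Tree A) → Pos t → Tree A
sub t here                    = t
sub (node a ts) (there i p)   = sub (lookup ts i) p

InAttr : {A : Set} → Tree A → A → Set
InAttr t a = ∃ λ (u : Pos t) → label t u ≡ a

-- Unlabelled rooted trees, given by a node set and a child relation
-- (Child u v : u is a child of v), and tree isomorphisms.

record RootedTree : Set₁ where
  field
    Node  : Set
    Child : Node → Node → Set

open RootedTree public

shape : {A : Set} → Tree A → RootedTree
shape t = record { Node = Pos t ; Child = ChildPos }

IsTreeIso : (R₁ R₂ : RootedTree) → (Node R₁ ↔ Node R₂) → Set
IsTreeIso R₁ R₂ φ = ∀ u v → Child R₁ u v ⇔ Child R₂ (Inverse.to φ u) (Inverse.to φ v)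

TreeIsomorphic : RootedTree → RootedTree → Set
TreeIsomorphic R₁ R₂ = Σ (Node R₁ ↔ Node R₂) (IsTreeIso R₁ R₂)

-- Tree ciphering.  The bijection f : attr(T₁) → attr(T₂) is given by
-- its graph F, a relation which is a bijection between attr(T₁) and attr(T₂).

IsAttrBijection : {A : Set} (t₁ t₂ : Tree A) → (A → A → Set) → Set
IsAttrBijection t₁ t₂ F =
    (∀ a b → F a b → InAttr t₁ a × InAttr t₂ b)
  × (∀ a → InAttr t₁ a → ∃ λ b → F a b)
  × (∀ a b b′ → F a b → F a b′ → b ≡ b′)
  × (∀ a a′ b → F a b → F a′ b → a ≡ a′)
  × (∀ b → InAttr t₂ b → ∃ λ a → F a b)

_∼_ : {A : Set} → Tree A → Tree A → Set₁
_∼_ {A} t₁ t₂ =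
  Σ (Pos t₁ ↔ Pos t₂) λ φ → IsTreeIso (shape t₁) (shape t₂) φ
  × Σ (A → A → Set) λ F → IsAttrBijection t₁ t₂ F
      × (∀ u → F (label t₁ u) (label t₂ (Inverse.to φ u)))

-- Its vertex set is given abstractly by a set V with
-- a surjection cls : nodes → V whose kernel is ∼ on subtrees (so
-- cls u plays the role of [u]∼).  Edges: E p q is the set of parallel
-- edges from p to q.

HasChildren : {A : Set} (T : Tree A) {V : Set} (cls : Pos T → V) → V → V → ℕ → Set
HasChildren T cls p q k =
  Σ (Pos T) λ u → cls u ≡ p ×
    Σ (Fin k → Pos T) λ v → Injective _≡_ _≡_ v ×
      (∀ i → ChildPos (v i) u × cls (v i) ≡ q)

IsMultiplicity : {A : Set} (T : Tree A) {V : Set} (cls : Pos T → V) → V → V → ℕ → Set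
IsMultiplicity T cls p q m =
  HasChildren T cls p q m × (∀ k → HasChildren T cls p q k → k ≤ m)

IsSource : {V : Set} (E : V → V → Set) → V → Set
IsSource E S = ∀ p → ¬ E p S

data Path {V : Set} (E : V → V → Set) : V → Set where
  []  : ∀ {p} → Path E p
  _∷_ : ∀ {p q} → E p q → Path E q → Path E p

data PathChild {V : Set} (E : V → V → Set) : {p : V} → Path E p → Path E p → Set where
  one  : ∀ {p q} (e : E p q) → PathChild E (e ∷ []) []
  step : ∀ {p q} (e : E p q) {ρ π : Path E q} →
         PathChild E ρ π → PathChild E (e ∷ ρ) (e ∷ π)

Unfolding : {V : Set} (E : V → V → Set) → V → RootedTree
Unfolding E S = record { Node = Path E S ; Child = PathChild E }

-- Colour every node u of T by its class [u].  A ciphering of T(u) onto T(w)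
-- sends the children of u injectively to children of w with ciphered, hence
-- equally coloured, subtrees.  So the number of children of class q of a node
-- of class p does not depend on the node, and by maximality it equals the
-- multiplicity of the edge (p, q): the colouring is a covering map from T to G,
-- bijective between the children of each node and the edges leaving its colour.
-- Unfolding G along a covering from the colour of the root rebuilds the tree,
-- and the colour of the root is the source because every other class receives
-- an edge from the class of a parent.

module Submission where

open import Defs
open import Data.Nat using (ℕ; suc; s≤s)
open import Data.Nat.Properties using (1+n≰n)
open import Data.Fin using (Fin; zero; suc)
open import Data.Fin.Properties using (_≟_; any?)
open import Data.List using (List; length; lookup)
open import Data.Product using (Σ; ∃; _×_; _,_; proj₁; proj₂)
open import Data.Sum using (_⊎_; inj₁; inj₂)
open import Data.Empty using (⊥-elim)
open import Function using (_∘_)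
open import Function.Bundles using (_↔_; _⇔_; Inverse; Injection; Equivalence; mk↔ₛ′; mk⇔)
open import Function.Definitions using (Injective)
open import Function.Properties.Inverse using (↔-sym; ↔-trans; ↔⇒↣)
open import Axiom.UniquenessOfIdentityProofs.WithK using (uip)
open import Relation.Binary.Construct.Closure.ReflexiveTransitive using (Star; ε; _◅_; _◅◅_; gmap)
open import Relation.Binary.PropositionalEquality
open import Relation.Nullary using (¬_; yes; no)

private variable
  A V : Set

children : Tree A → List (Tree A)
children (node _ ts) = ts

ChildIndex : (t : Tree A) → Pos t → Set
ChildIndex t w = Fin (length (children (sub t w)))

child : (t : Tree A) (w : Pos t) → ChildIndex t w → Pos t
child (node _ _)  here        k = there k here
child (node _ ts) (there i w) k = there i (child (lookup ts i) w k)

child-isChild : ∀ (t : Tree A) w k → ChildPos (child t w k) w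
child-isChild (node _ _)  here        k = top k
child-isChild (node _ ts) (there i w) k = down i (child-isChild (lookup ts i) w k)

isChild⇒child : ∀ {t : Tree A} {v w} → ChildPos v w → ∃ λ k → v ≡ child t w k
isChild⇒child (top k) = k , refl
isChild⇒child (down i c) with isChild⇒child c
... | k , refl = k , refl

there-injective : ∀ {a : A} {ts i} {x y : Pos (lookup ts i)} →
                  there {a = a} {ts} i x ≡ there i y → x ≡ y
there-injective refl = refl

child-injective : ∀ (t : Tree A) w → Injective _≡_ _≡_ (child t w)
child-injective (node _ _)  here        refl = refl
child-injective (node _ ts) (there i w) eq   = child-injective (lookup ts i) w (there-injective eq)

sub-child : ∀ (t : Tree A) w k → sub t (child t w k) ≡ lookup (children (sub t w)) k
sub-child (node _ _)  here        k = refl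
sub-child (node _ ts) (there i w) k = sub-child (lookup ts i) w k

root-hasNoParent : ∀ {t : Tree A} {v : Pos t} → ¬ ChildPos here v
root-hasNoParent ()

mutual
  root-isAncestor : ∀ {t : Tree A} (v : Pos t) → Star ChildPos v here
  root-isAncestor here        = ε
  root-isAncestor (there k v) = rootChild-isAncestor k v ◅◅ (top k ◅ ε)

  rootChild-isAncestor : ∀ {a : A} {ts} k (v : Pos (lookup ts k)) →
                         Star (ChildPos {t = node a ts}) (there k v) (there k here)
  rootChild-isAncestor k v = gmap (there k) (down k) (root-isAncestor v)

root-or-hasParent : ∀ {t : Tree A} (v : Pos t) → v ≡ here ⊎ ∃ (ChildPos v)
root-or-hasParent v with root-isAncestor v
... | ε     = inj₁ refl
... | c ◅ _ = inj₂ (_ , c)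

child-of-there : ∀ {a : A} {ts j} {v} {w : Pos (lookup ts j)} →
                 ChildPos {t = node a ts} v (there j w) → ∃ λ v′ → v ≡ there j v′
child-of-there (down _ _) = _ , refl

descendant-of-there : ∀ {a : A} {ts j} {v} {w : Pos (lookup ts j)} →
                      Star (ChildPos {t = node a ts}) v (there j w) → ∃ λ v′ → v ≡ there j v′
descendant-of-there ε = _ , refl
descendant-of-there (c ◅ s) with descendant-of-there s
... | _ , refl = child-of-there c

childOfRoot-there : ∀ {a : A} {ts k} {v : Pos (lookup ts k)} →
                    ChildPos {t = node a ts} (there k v) here → v ≡ here
childOfRoot-there (top _) = refl

there-child : ∀ {a : A} {ts k} {u v : Pos (lookup ts k)} →
              ChildPos {t = node a ts} (there k u) (there k v) → ChildPos u v
there-child (down _ c) = c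

isTreeIso-sym : ∀ {R₁ R₂} (φ : Node R₁ ↔ Node R₂) → IsTreeIso R₁ R₂ φ → IsTreeIso R₂ R₁ (↔-sym φ)
isTreeIso-sym {R₂ = R₂} φ φ-iso u v = mk⇔
  (λ c → Equivalence.from (φ-iso (from u) (from v))
           (subst₂ (Child R₂) (sym (strictlyInverseˡ u)) (sym (strictlyInverseˡ v)) c))
  (λ c → subst₂ (Child R₂) (strictlyInverseˡ u) (strictlyInverseˡ v) (Equivalence.to (φ-iso _ _) c))
  where open Inverse φ

module ShapeIso {t₁ t₂ : Tree A} (φ : Pos t₁ ↔ Pos t₂) (φ-iso : IsTreeIso (shape t₁) (shape t₂) φ) where
  open Inverse φ

  to-child : ∀ {u v} → ChildPos u v → ChildPos (to u) (to v)
  to-child = Equivalence.to (φ-iso _ _)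

  to-root : to here ≡ here
  to-root with root-or-hasParent (to here)
  ... | inj₁ eq      = eq
  ... | inj₂ (v , c) = ⊥-elim (root-hasNoParent (Equivalence.from (φ-iso here (from v))
                                  (subst (ChildPos (to here)) (sym (strictlyInverseˡ v)) c)))

module RootChildShapeIso {a₁ a₂ : A} {ts₁ ts₂} (φ : Pos (node a₁ ts₁) ↔ Pos (node a₂ ts₂))
                         (φ-iso : IsTreeIso (shape (node a₁ ts₁)) (shape (node a₂ ts₂)) φ) where
  open Inverse φ
  open ShapeIso φ φ-iso

  to-rootChild : ∀ k → ∃ λ j → to (there k here) ≡ there j here
  to-rootChild k = isChild⇒child (subst (ChildPos _) to-root (to-child (top k)))

  to-descendant : ∀ {k j} → to (there k here) ≡ there j here →
                  ∀ v → ∃ λ w → to (there k v) ≡ there j w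
  to-descendant {k} eq v =
    descendant-of-there (subst (Star ChildPos _) eq (gmap to to-child (rootChild-isAncestor k v)))

restrict-rootChild : ∀ {a₁ a₂ : A} {ts₁ ts₂} (φ : Pos (node a₁ ts₁) ↔ Pos (node a₂ ts₂)) →
                     IsTreeIso (shape (node a₁ ts₁)) (shape (node a₂ ts₂)) φ →
                     ∀ {k j} → Inverse.to φ (there k here) ≡ there j here →
                     Σ (Pos (lookup ts₁ k) ↔ Pos (lookup ts₂ j)) λ ψ →
                       IsTreeIso (shape (lookup ts₁ k)) (shape (lookup ts₂ j)) ψ
                       × ∀ v → Inverse.to φ (there k v) ≡ there j (Inverse.to ψ v)
restrict-rootChild {ts₁ = ts₁} {ts₂ = ts₂} φ φ-iso {k} {j} to-k =
  mk↔ₛ′ ψ ψ⁻ ψ-ψ⁻ ψ⁻-ψ , ψ-iso , ψ-spec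
  where
  open Inverse φ
  module Φ  = RootChildShapeIso φ φ-iso
  module Φ⁻ = RootChildShapeIso (↔-sym φ) (isTreeIso-sym φ φ-iso)

  from-j : from (there j here) ≡ there k here
  from-j = trans (cong from (sym to-k)) (strictlyInverseʳ _)

  ψ : Pos (lookup ts₁ k) → Pos (lookup ts₂ j)
  ψ v = proj₁ (Φ.to-descendant to-k v)
  ψ-spec : ∀ v → to (there k v) ≡ there j (ψ v)
  ψ-spec v = proj₂ (Φ.to-descendant to-k v)

  ψ⁻ : Pos (lookup ts₂ j) → Pos (lookup ts₁ k)
  ψ⁻ w = proj₁ (Φ⁻.to-descendant from-j w)
  ψ⁻-spec : ∀ w → from (there j w) ≡ there k (ψ⁻ w)
  ψ⁻-spec w = proj₂ (Φ⁻.to-descendant from-j w)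

  ψ-ψ⁻ : ∀ w → ψ (ψ⁻ w) ≡ w
  ψ-ψ⁻ w = there-injective (begin
    there j (ψ (ψ⁻ w))  ≡⟨ ψ-spec (ψ⁻ w) ⟨
    to (there k (ψ⁻ w)) ≡⟨ cong to (ψ⁻-spec w) ⟨
    to (from (there j w)) ≡⟨ strictlyInverseˡ _ ⟩
    there j w ∎)
    where open ≡-Reasoning

  ψ⁻-ψ : ∀ v → ψ⁻ (ψ v) ≡ v
  ψ⁻-ψ v = there-injective (begin
    there k (ψ⁻ (ψ v))  ≡⟨ ψ⁻-spec (ψ v) ⟨
    from (there j (ψ v)) ≡⟨ cong from (ψ-spec v) ⟨
    from (to (there k v)) ≡⟨ strictlyInverseʳ _ ⟩
    there k v ∎)
    where open ≡-Reasoning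

  ψ-iso : IsTreeIso (shape (lookup ts₁ k)) (shape (lookup ts₂ j)) (mk↔ₛ′ ψ ψ⁻ ψ-ψ⁻ ψ⁻-ψ)
  ψ-iso u v = mk⇔
    (λ c → there-child (subst₂ ChildPos (ψ-spec u) (ψ-spec v) (Equivalence.to (φ-iso _ _) (down k c))))
    (λ c → there-child (Equivalence.from (φ-iso _ _)
                           (subst₂ ChildPos (sym (ψ-spec u)) (sym (ψ-spec v)) (down j c))))

ciphering-along : ∀ {A : Set} {s₁ s₂ : Tree A} (ψ : Pos s₁ ↔ Pos s₂) → IsTreeIso (shape s₁) (shape s₂) ψ →
                  (F : A → A → Set) →
                  (∀ a b b′ → F a b → F a b′ → b ≡ b′) → (∀ a a′ b → F a b → F a′ b → a ≡ a′) →
                  (∀ v → F (label s₁ v) (label s₂ (Inverse.to ψ v))) → s₁ ∼ s₂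
ciphering-along {A} {s₁} {s₂} ψ ψ-iso F F-functional F-injective F-labels =
  ψ , ψ-iso , F′ , (F′-attr , F′-total , F′-functional , F′-injective , F′-surjective) , F′-labels
  where
  open Inverse ψ

  F′ : A → A → Set
  F′ a b = F a b × InAttr s₁ a × InAttr s₂ b

  F′-labels : ∀ v → F′ (label s₁ v) (label s₂ (to v))
  F′-labels v = F-labels v , (v , refl) , (to v , refl)

  F′-attr : ∀ a b → F′ a b → InAttr s₁ a × InAttr s₂ b
  F′-attr _ _ (_ , a∈ , b∈) = a∈ , b∈

  F′-total : ∀ a → InAttr s₁ a → ∃ (F′ a)
  F′-total _ (v , refl) = _ , F′-labels v

  F′-functional : ∀ a b b′ → F′ a b → F′ a b′ → b ≡ b′
  F′-functional a b b′ Fab Fab′ = F-functional a b b′ (proj₁ Fab) (proj₁ Fab′)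

  F′-injective : ∀ a a′ b → F′ a b → F′ a′ b → a ≡ a′
  F′-injective a a′ b Fab Fa′b = F-injective a a′ b (proj₁ Fab) (proj₁ Fa′b)

  F′-surjective : ∀ b → InAttr s₂ b → ∃ λ a → F′ a b
  F′-surjective _ (w , refl) = _ , subst (λ w′ → F′ _ (label s₂ w′)) (strictlyInverseˡ w) (F′-labels (from w))

∼-rootChildren : ∀ (t₁ t₂ : Tree A) → t₁ ∼ t₂ →
                 Σ (Fin (length (children t₁)) → Fin (length (children t₂))) λ g →
                   Injective _≡_ _≡_ g × ∀ k → lookup (children t₁) k ∼ lookup (children t₂) (g k)
∼-rootChildren (node a₁ ts₁) (node a₂ ts₂)
               (φ , φ-iso , F , (_ , _ , F-functional , F-injective , _) , F-labels) =
  index , index-injective , subtree-∼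
  where
  open Inverse φ using (to)
  open RootChildShapeIso φ φ-iso using (to-rootChild)

  index : Fin (length ts₁) → Fin (length ts₂)
  index k = proj₁ (to-rootChild k)

  index-spec : ∀ k → to (there k here) ≡ there (index k) here
  index-spec k = proj₂ (to-rootChild k)

  index-injective : Injective _≡_ _≡_ index
  index-injective {k} {k′} eq = child-injective (node a₁ ts₁) here
    (Injection.injective (↔⇒↣ φ)
      (trans (index-spec k) (trans (cong (child (node a₂ ts₂) here) eq) (sym (index-spec k′)))))

  subtree-∼ : ∀ k → lookup ts₁ k ∼ lookup ts₂ (index k)
  subtree-∼ k with restrict-rootChild φ φ-iso (index-spec k)
  ... | ψ , ψ-iso , ψ-spec = ciphering-along ψ ψ-iso F F-functional F-injective
          (λ v → subst (F _) (cong (label (node a₂ ts₂)) (ψ-spec v)) (F-labels (there k v)))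

ColouredChildren : (t : Tree A) → (Pos t → V) → Pos t → V → Set
ColouredChildren t c w q = Σ (ChildIndex t w) λ k → c (child t w k) ≡ q

module _ {A V : Set} (E : V → V → Set) where

  IsCovering : (t : Tree A) → (Pos t → V) → Set
  IsCovering t c = ∀ w q → ColouredChildren t c w q ↔ E (c w) q

  private variable
    a : A
    ts : List (Tree A)
    c : Pos (node a ts) → V

  covering-restrict : IsCovering (node a ts) c → ∀ k → IsCovering (lookup ts k) (c ∘ there k)
  covering-restrict H k w = H (there k w)

  -- The equation in pathToPos lets the recursion enter a subtree whose root
  -- colour is only propositionally the target of the edge taken.
  mutual
    pathToPos : ∀ t (c : Pos t → V) → IsCovering t c → ∀ {p} → c here ≡ p → Path E p → Pos t
    pathToPos t c H _    []      = here
    pathToPos t c H refl (e ∷ π) = descend t c H (Inverse.from (H here _) e) π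

    descend : ∀ t (c : Pos t → V) → IsCovering t c →
              ∀ {q} → ColouredChildren t c here q → Path E q → Pos t
    descend (node a ts) c H (k , c≡q) π =
      there k (pathToPos (lookup ts k) (c ∘ there k) (covering-restrict H k) c≡q π)

  posToPath : ∀ t (c : Pos t → V) → IsCovering t c → Pos t → Path E (c here)
  posToPath t           c H here        = []
  posToPath (node a ts) c H (there k w) =
    Inverse.to (H here _) (k , refl) ∷ posToPath (lookup ts k) (c ∘ there k) (covering-restrict H k) w

  pathToPos-posToPath : ∀ t c H (w : Pos t) → pathToPos t c H refl (posToPath t c H w) ≡ w
  pathToPos-posToPath t           c H here        = refl
  pathToPos-posToPath (node a ts) c H (there k w) = begin
      descend (node a ts) c H (Inverse.from (H here _) (Inverse.to (H here _) (k , refl))) π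
    ≡⟨ cong (λ x → descend (node a ts) c H x π) (Inverse.strictlyInverseʳ (H here _) (k , refl)) ⟩
      there k (pathToPos (lookup ts k) (c ∘ there k) (covering-restrict H k) refl π)
    ≡⟨ cong (there k) (pathToPos-posToPath (lookup ts k) (c ∘ there k) (covering-restrict H k) w) ⟩
      there k w
    ∎
    where
    open ≡-Reasoning
    π : Path E (c (there k here))
    π = posToPath (lookup ts k) (c ∘ there k) (covering-restrict H k) w

  mutual
    posToPath-pathToPos : ∀ t c H (π : Path E (c here)) →
                          posToPath t c H (pathToPos t c H refl π) ≡ π
    posToPath-pathToPos t c H []      = refl
    posToPath-pathToPos t c H (e ∷ π) =
      trans (posToPath-descend t c H (Inverse.from (H here _) e) π)
            (cong (_∷ π) (Inverse.strictlyInverseˡ (H here _) e))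

    posToPath-descend : ∀ t c H {q} (x : ColouredChildren t c here q) π →
                        posToPath t c H (descend t c H x π) ≡ Inverse.to (H here q) x ∷ π
    posToPath-descend (node a ts) c H (k , refl) π =
      cong (_ ∷_) (posToPath-pathToPos (lookup ts k) (c ∘ there k) (covering-restrict H k) π)

  descend-[]-isChild : ∀ t c H {q} (x : ColouredChildren t c here q) →
                       ChildPos (descend t c H x []) here
  descend-[]-isChild (node a ts) c H (k , refl) = top k

  mutual
    pathToPos-child : ∀ t c H {ρ π : Path E (c here)} →
                      PathChild E ρ π → ChildPos (pathToPos t c H refl ρ) (pathToPos t c H refl π)
    pathToPos-child t c H (one e)     = descend-[]-isChild t c H (Inverse.from (H here _) e)
    pathToPos-child t c H (step e ρπ) = descend-child t c H (Inverse.from (H here _) e) ρπ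

    descend-child : ∀ t c H {q} (x : ColouredChildren t c here q) {ρ π : Path E q} →
                    PathChild E ρ π → ChildPos (descend t c H x ρ) (descend t c H x π)
    descend-child (node a ts) c H (k , refl) ρπ =
      down k (pathToPos-child (lookup ts k) (c ∘ there k) (covering-restrict H k) ρπ)

  descend≢here : ∀ t c H {q} (x : ColouredChildren t c here q) π → descend t c H x π ≢ here
  descend≢here (node a ts) c H (k , _) π ()

  descend-childOfRoot : ∀ t c H {q} (x : ColouredChildren t c here q) ρ →
                        ChildPos (descend t c H x ρ) here → ρ ≡ []
  descend-childOfRoot (node a ts) c H (k , refl) []      _       = refl
  descend-childOfRoot (node a ts) c H (k , refl) (e ∷ ρ) ch =
    ⊥-elim (descend≢here (lookup ts k) (c ∘ there k) (covering-restrict H k) _ ρ (childOfRoot-there ch))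

  mutual
    pathToPos-child⁻¹ : ∀ t c H (ρ π : Path E (c here)) →
                        ChildPos (pathToPos t c H refl ρ) (pathToPos t c H refl π) → PathChild E ρ π
    pathToPos-child⁻¹ t c H []       _        ()
    pathToPos-child⁻¹ t c H (e ∷ ρ)  []       ρπ
      with descend-childOfRoot t c H (Inverse.from (H here _) e) ρ ρπ
    ... | refl = one e
    pathToPos-child⁻¹ t c H (e′ ∷ ρ) (e ∷ π) ρπ
      with descend-child⁻¹ t c H (Inverse.from (H here _) e′) (Inverse.from (H here _) e) ρ π ρπ
    ... | refl , x′≡x , ρπ′ rewrite Injection.injective (↔⇒↣ (↔-sym (H here _))) x′≡x = step e ρπ′

    descend-child⁻¹ : ∀ t c H {q′ q} (x′ : ColouredChildren t c here q′) (x : ColouredChildren t c here q) →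
                      ∀ ρ π →
                      ChildPos (descend t c H x′ ρ) (descend t c H x π) →
                      Σ (q′ ≡ q) λ { refl → x′ ≡ x × PathChild E ρ π }
    descend-child⁻¹ (node a ts) c H (k , refl) (.k , refl) ρ π (down .k ρπ) =
      refl , refl , pathToPos-child⁻¹ (lookup ts k) (c ∘ there k) (covering-restrict H k) ρ π ρπ

  unfolding≅shape : ∀ t c → IsCovering t c → TreeIsomorphic (Unfolding E (c here)) (shape t)
  unfolding≅shape t c H =
      mk↔ₛ′ (pathToPos t c H refl) (posToPath t c H) (pathToPos-posToPath t c H) (posToPath-pathToPos t c H)
    , λ ρ π → mk⇔ (pathToPos-child t c H) (pathToPos-child⁻¹ t c H ρ π)

module _ {A V : Set} {T : Tree A} (cls : Pos T → V)
         (cls-∼ : ∀ u v → cls u ≡ cls v ⇔ (sub T u ∼ sub T v)) where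

  similar-children : ∀ {u w} → cls u ≡ cls w →
                     Σ (ChildIndex T u → ChildIndex T w) λ g →
                       Injective _≡_ _≡_ g × ∀ k → cls (child T w (g k)) ≡ cls (child T u k)
  similar-children {u} {w} eq with ∼-rootChildren (sub T u) (sub T w) (Equivalence.to (cls-∼ u w) eq)
  ... | g , g-injective , g-∼ = g , g-injective , λ k → sym (Equivalence.from (cls-∼ _ _)
          (subst₂ _∼_ (sym (sub-child T u k)) (sym (sub-child T w (g k))) (g-∼ k)))

  colouredChildren-injection : ∀ {w q m} → HasChildren T cls (cls w) q m →
                               Σ (Fin m → ChildIndex T w) λ h →
                                 Injective _≡_ _≡_ h × ∀ i → cls (child T w (h i)) ≡ q
  colouredChildren-injection {w} (u , cls-u , v , v-injective , v-child) =
    g ∘ κ , (λ eq → v-injective (trans (κ-spec _) (trans (cong (child T u) (g-injective eq)) (sym (κ-spec _)))))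
          , λ i → trans (g-cls (κ i)) (trans (cong cls (sym (κ-spec i))) (proj₂ (v-child i)))
    where
    κ : ∀ i → ChildIndex T u
    κ i = proj₁ (isChild⇒child (proj₁ (v-child i)))
    κ-spec : ∀ i → v i ≡ child T u (κ i)
    κ-spec i = proj₂ (isChild⇒child (proj₁ (v-child i)))
    g : ChildIndex T u → ChildIndex T w
    g = proj₁ (similar-children cls-u)
    g-injective : Injective _≡_ _≡_ g
    g-injective = proj₁ (proj₂ (similar-children cls-u))
    g-cls : ∀ k → cls (child T w (g k)) ≡ cls (child T u k)
    g-cls = proj₂ (proj₂ (similar-children cls-u))

  colouredChildren↔multiplicity : ∀ {w q m} → IsMultiplicity T cls (cls w) q m →
                                  ColouredChildren T cls w q ↔ Fin m
  colouredChildren↔multiplicity {w} {q} {m} (witness , maximal) =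
    mk↔ₛ′ index (λ i → h i , h-cls i) (λ i → h-injective (proj₂ (covers (h i) (h-cls i)))) index-inverse
    where
    h : Fin m → ChildIndex T w
    h = proj₁ (colouredChildren-injection witness)
    h-injective : Injective _≡_ _≡_ h
    h-injective = proj₁ (proj₂ (colouredChildren-injection witness))
    h-cls : ∀ i → cls (child T w (h i)) ≡ q
    h-cls = proj₂ (proj₂ (colouredChildren-injection witness))

    extension : ∀ {k} → cls (child T w k) ≡ q → (∀ i → h i ≢ k) → HasChildren T cls (cls w) q (suc m)
    extension {k} k-cls k-new =
      w , refl , child T w ∘ h⁺ , h⁺-injective ∘ child-injective T w ,
      λ i → child-isChild T w (h⁺ i) , h⁺-cls i
      where
      h⁺ : Fin (suc m) → ChildIndex T w
      h⁺ zero    = k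
      h⁺ (suc i) = h i
      h⁺-injective : Injective _≡_ _≡_ h⁺
      h⁺-injective {zero}  {zero}  _  = refl
      h⁺-injective {zero}  {suc j} eq = ⊥-elim (k-new j (sym eq))
      h⁺-injective {suc i} {zero}  eq = ⊥-elim (k-new i eq)
      h⁺-injective {suc i} {suc j} eq = cong suc (h-injective eq)
      h⁺-cls : ∀ i → cls (child T w (h⁺ i)) ≡ q
      h⁺-cls zero    = k-cls
      h⁺-cls (suc i) = h-cls i

    covers : ∀ k → cls (child T w k) ≡ q → ∃ λ i → h i ≡ k
    covers k k-cls with any? (λ i → h i ≟ k)
    ... | yes k∈h = k∈h
    ... | no  k∉h = ⊥-elim (1+n≰n (maximal (suc m) (extension k-cls λ i hi≡k → k∉h (i , hi≡k))))

    index : ColouredChildren T cls w q → Fin m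
    index (k , k-cls) = proj₁ (covers k k-cls)

    index-inverse : ∀ x → (h (index x) , h-cls (index x)) ≡ x
    index-inverse (k , k-cls) with covers k k-cls
    ... | i , refl = cong (h i ,_) (uip (h-cls i) k-cls)

module _ {A V : Set} {T : Tree A} (cls : Pos T → V) (E : V → V → Set)
         (multiplicity : ∀ p q → Σ ℕ λ m → IsMultiplicity T cls p q m × (E p q ↔ Fin m)) where

  child⇒edge : ∀ {u v} → ChildPos u v → E (cls v) (cls u)
  child⇒edge {u} {v} c with multiplicity (cls v) (cls u)
  ... | m , (_ , maximal) , E↔Fin
    with maximal 1 (v , refl , (λ _ → u) , (λ { {zero} {zero} _ → refl }) , λ _ → c , refl)
  ... | s≤s _ = Inverse.from E↔Fin zero

  root-class≡source : (∀ p → ∃ λ u → cls u ≡ p) → ∀ {S} → IsSource E S → cls here ≡ S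
  root-class≡source surjective {S} S-source with surjective S
  ... | u , refl with root-or-hasParent u
  ...   | inj₁ refl    = refl
  ...   | inj₂ (v , c) = ⊥-elim (S-source (cls v) (child⇒edge c))

lemma3 : {A : Set} (T : Tree A)
    (V : Set) (cls : Pos T → V)
    → (∀ p → ∃ λ u → cls u ≡ p)
    → (∀ u v → cls u ≡ cls v ⇔ (sub T u ∼ sub T v))
    → (E : V → V → Set)
    → (∀ p q → Σ ℕ λ m → IsMultiplicity T cls p q m × (E p q ↔ Fin m))
    → (S : V) → IsSource E S → (∀ p → IsSource E p → p ≡ S)
    → TreeIsomorphic (Unfolding E S) (shape T)
lemma3 T V cls surjective cls-∼ E multiplicity S S-source _ =
  subst (λ p → TreeIsomorphic (Unfolding E p) (shape T))
        (root-class≡source cls E multiplicity surjective S-source)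
        (unfolding≅shape E T cls covering)
  where
  covering : IsCovering E T cls
  covering w q with multiplicity (cls w) q
  ... | m , mult , E↔Fin = ↔-trans (colouredChildren↔multiplicity cls cls-∼ mult) (↔-sym E↔Fin)
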